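{- Fix an integer $n\ge 0$ and start the chip-firing game on the quadrant lattice graph with $2^n$ chips at $(0,0)$. Let $T(n)$ be the total number of firings performed until the stable configuration is reached, and for each integer $i$ let $D_n(i)$ be the total number of chips in the stable configuration on the vertices $(x,y)$ with $y-x=i$. Then \[\sum_{i\in\mathbb{Z}} i^2 D_n(i) = 2T(n).\]
   Context: The quadrant lattice graph is the directed graph with vertex set $\{(x,y): x,y\in\mathbb{Z}_{\ge 0}\}$ and edges $(x,y)\to(x+1,y)$ and $(x,y)\to(x,y+1)$. In the chip-firing game, a vertex holding at least $2$ chips may fire, sending one chip to each of its two out-neighbours. Starting from $2^n$ chips at $(0,0)$ the process terminates, and the resulting stable configuration (no vertex can fire), as well as the total number of firings, do not depend on the order of firings. -}

module Defs where

open import Data.Nat using (ℕ; zero; suc; _+_; _*_; _∸_; _^_; _≤_; _<_)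
open import Data.Nat.Properties using (_≟_)
open import Data.Integer as ℤ using (ℤ; +_)
open import Data.Integer.Properties as ℤP using ()
open import Data.List using (List; []; _∷_; map; upTo; length; concatMap; foldr)
open import Data.Nat.ListAction using (sum)
open import Data.Product using (_×_; _,_)
open import Data.Sum using (_⊎_)
open import Data.Unit using (⊤)
open import Data.Bool using (if_then_else_; _∧_)
open import Relation.Nullary.Decidable using (⌊_⌋)
open import Relation.Binary.PropositionalEquality using (_≡_)

Config : Set
Config = ℕ → ℕ → ℕ

Vertex : Set
Vertex = ℕ × ℕ

δ : Vertex → ℕ → ℕ → ℕ
δ (a , b) x y = if ⌊ a ≟ x ⌋ ∧ ⌊ b ≟ y ⌋ then 1 else 0

fire : Config → Vertex → Config
fire c (a , b) x y =
  (c x y + δ (suc a , b) x y + δ (a , suc b) x y) ∸ 2 * δ (a , b) x y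

run : Config → List Vertex → Config
run c [] = c
run c (v ∷ vs) = run (fire c v) vs

Legal : Config → List Vertex → Set
Legal c [] = ⊤
Legal c ((a , b) ∷ vs) = (2 ≤ c a b) × Legal (fire c (a , b)) vs

Stable : Config → Set
Stable c = ∀ x y → c x y < 2

initial : ℕ → Config
initial n x y = δ (0 , 0) x y * 2 ^ n

SupportedIn : ℕ → Config → Set
SupportedIn N c = ∀ x y → N < x ⊎ N < y → c x y ≡ 0

-- D N c i : total number of chips of c on vertices (x , y) with y - x = i,
-- summed over the box [0,N]² (which contains the support of c when
-- SupportedIn N c holds, so then this is exactly D(i)).
D : ℕ → Config → ℤ → ℕ
D N c i = sum (concatMap (λ x → map (λ y →
            if ⌊ (+ y ℤ.- + x) ℤ.≟ i ⌋ then c x y else 0)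
            (upTo (suc N))) (upTo (suc N)))

-- Σ_{i ∈ ℤ} i² D(i); for c supported in [0,N]², D(i) = 0 unless -N ≤ i ≤ N.
secondMoment : ℕ → Config → ℤ
secondMoment N c = foldr ℤ._+_ (+ 0)
             (map (λ k → let i = + k ℤ.- + N in i ℤ.* i ℤ.* + D N c i)
                  (upTo (suc (2 * N))))

{-# OPTIONS --safe #-}

-- Call i = y − x the diagonal of the vertex (x , y). Firing a vertex on diagonal i takes two
-- chips off it and puts one on each of the diagonals i − 1 and i + 1, so Σ i² D(i) grows by
-- (i − 1)² + (i + 1)² − 2 i² = 2 per firing, and it starts at 0 because all chips start on
-- diagonal 0. To make this a statement about finite sums, the moment is taken over a box that
-- contains every configuration of the run: after k firings all chips lie in x + y ≤ k.

module Submission where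

open import Defs
import Data.Integer.Properties as ℤP
open import Algebra.Properties.AbelianGroup ℤP.+-0-abelianGroup
  using () renaming (∙-cancelʳ to +-cancelʳ)
open import Algebra.Properties.CommutativeSemigroup ℤP.+-commutativeSemigroup
  using () renaming (interchange to +-interchange)
open import Algebra.Properties.CommutativeSemigroup ℤP.*-commutativeSemigroup
  using () renaming (x∙yz≈y∙xz to *-left-comm)
open import Data.Bool using (if_then_else_)
open import Data.Empty using (⊥-elim)
open import Data.Integer as ℤ using (ℤ; +_; _⊖_)
open import Data.Integer.Tactic.RingSolver using (solve-∀)
open import Data.List using (List; []; _∷_; length; map; foldr; upTo; applyUpTo; concatMap)
open import Data.List.Properties using (map-applyUpTo)
open import Data.Nat using (ℕ; zero; suc; _+_; _*_; _^_; _∸_; _≤_; _<_; z≤n; s≤s; z<s; s<s; _≟_)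
open import Data.Nat.ListAction using (sum)
open import Data.Nat.ListAction.Properties using (sum-++)
open import Data.Nat.Properties
  using (suc-injective; ≤-trans; ≤-reflexive; ≤-<-trans; <⇒≤; <⇒≱; ≮⇒≥; <-irrefl; m≤m+n; m≤n+m;
         +-mono-≤; +-suc; *-suc; m∸n≤m; m∸n+n≡m; 0∸n≡0)
open import Data.Product using (_,_; proj₁; proj₂)
open import Data.Sum using (_⊎_; inj₁; inj₂)
open import Function using (id; _∘_)
open import Relation.Nullary using (yes; no)
open import Relation.Nullary.Decidable using (⌊_⌋)
open import Relation.Binary.PropositionalEquality
  using (_≡_; _≢_; refl; sym; trans; cong; cong₂; subst; module ≡-Reasoning)

open ≡-Reasoning

Σ< : ℕ → (ℕ → ℤ) → ℤ
Σ< zero    f = + 0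
Σ< (suc n) f = f 0 ℤ.+ Σ< n (f ∘ suc)

infix 5 Σ<
syntax Σ< n (λ k → e) = Σ[ k < n ] e

Σ<-cong : ∀ n {f g : ℕ → ℤ} → (∀ k → k < n → f k ≡ g k) → Σ< n f ≡ Σ< n g
Σ<-cong zero    f≗g = refl
Σ<-cong (suc n) f≗g = cong₂ ℤ._+_ (f≗g 0 z<s) (Σ<-cong n (λ k k<n → f≗g (suc k) (s<s k<n)))

Σ<-zero : ∀ n {f : ℕ → ℤ} → (∀ k → k < n → f k ≡ + 0) → Σ< n f ≡ + 0
Σ<-zero zero    f≗0 = refl
Σ<-zero (suc n) f≗0 = cong₂ ℤ._+_ (f≗0 0 z<s) (Σ<-zero n (λ k k<n → f≗0 (suc k) (s<s k<n)))

Σ<-single : ∀ n {f : ℕ → ℤ} k₀ → k₀ < n → (∀ k → k < n → k ≢ k₀ → f k ≡ + 0) → Σ< n f ≡ f k₀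
Σ<-single (suc n) {f} zero _ f≗0 =
  trans (cong (ℤ._+_ (f 0)) (Σ<-zero n (λ k k<n → f≗0 (suc k) (s<s k<n) (λ ()))))
        (ℤP.+-identityʳ (f 0))
Σ<-single (suc n) {f} (suc k₀) (s<s k₀<n) f≗0 =
  trans (cong₂ ℤ._+_ (f≗0 0 z<s (λ ()))
                     (Σ<-single n k₀ k₀<n (λ k k<n k≢k₀ → f≗0 (suc k) (s<s k<n) (k≢k₀ ∘ suc-injective))))
        (ℤP.+-identityˡ (f (suc k₀)))

Σ<-extend : ∀ {n m} (f : ℕ → ℤ) → n ≤ m → (∀ k → n ≤ k → k < m → f k ≡ + 0) → Σ< m f ≡ Σ< n f
Σ<-extend {zero}  {m}     f _         f≗0 = Σ<-zero m (λ k → f≗0 k z≤n)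
Σ<-extend {suc n} {suc m} f (s≤s n≤m) f≗0 =
  cong (ℤ._+_ (f 0)) (Σ<-extend (f ∘ suc) n≤m (λ k n≤k k<m → f≗0 (suc k) (s≤s n≤k) (s<s k<m)))

Σ<-+ : ∀ n (f g : ℕ → ℤ) → Σ[ k < n ] (f k ℤ.+ g k) ≡ Σ< n f ℤ.+ Σ< n g
Σ<-+ zero    f g = refl
Σ<-+ (suc n) f g =
  trans (cong (ℤ._+_ (f 0 ℤ.+ g 0)) (Σ<-+ n (f ∘ suc) (g ∘ suc)))
        (+-interchange (f 0) (g 0) (Σ< n (f ∘ suc)) (Σ< n (g ∘ suc)))

*-distribˡ-Σ< : ∀ n a (f : ℕ → ℤ) → a ℤ.* Σ< n f ≡ Σ[ k < n ] (a ℤ.* f k)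
*-distribˡ-Σ< zero    a f = ℤP.*-zeroʳ a
*-distribˡ-Σ< (suc n) a f =
  trans (ℤP.*-distribˡ-+ a (f 0) _) (cong (ℤ._+_ (a ℤ.* f 0)) (*-distribˡ-Σ< n a (f ∘ suc)))

Σ<-comm : ∀ m n (f : ℕ → ℕ → ℤ) → Σ[ i < m ] Σ< n (f i) ≡ Σ[ j < n ] Σ[ i < m ] f i j
Σ<-comm zero    n f = sym (Σ<-zero n (λ _ _ → refl))
Σ<-comm (suc m) n f =
  trans (cong (ℤ._+_ (Σ< n (f 0))) (Σ<-comm m n (f ∘ suc))) (sym (Σ<-+ n (f 0) _))

foldr-applyUpTo : ∀ n (f : ℕ → ℤ) → foldr ℤ._+_ (+ 0) (applyUpTo f n) ≡ Σ< n f
foldr-applyUpTo zero    f = refl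
foldr-applyUpTo (suc n) f = cong (ℤ._+_ (f 0)) (foldr-applyUpTo n (f ∘ suc))

foldr-map-upTo : ∀ n (f : ℕ → ℤ) → foldr ℤ._+_ (+ 0) (map f (upTo n)) ≡ Σ< n f
foldr-map-upTo n f = trans (cong (foldr ℤ._+_ (+ 0)) (map-applyUpTo id f n)) (foldr-applyUpTo n f)

+-sum-applyUpTo : ∀ n (f : ℕ → ℕ) → + sum (applyUpTo f n) ≡ Σ[ k < n ] + f k
+-sum-applyUpTo zero    f = refl
+-sum-applyUpTo (suc n) f =
  trans (ℤP.pos-+ (f 0) _) (cong (ℤ._+_ (+ f 0)) (+-sum-applyUpTo n (f ∘ suc)))

+-sum-map-upTo : ∀ n (f : ℕ → ℕ) → + sum (map f (upTo n)) ≡ Σ[ k < n ] + f k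
+-sum-map-upTo n f = trans (cong (+_ ∘ sum) (map-applyUpTo id f n)) (+-sum-applyUpTo n f)

sum-concatMap : ∀ {A : Set} (f : A → List ℕ) xs → sum (concatMap f xs) ≡ sum (map (sum ∘ f) xs)
sum-concatMap f []       = refl
sum-concatMap f (x ∷ xs) =
  trans (sum-++ (f x) (concatMap f xs)) (cong (_+_ (sum (f x))) (sum-concatMap f xs))

boxSum : ℕ → (ℕ → ℕ → ℤ) → ℤ
boxSum M f = Σ[ x < suc M ] Σ[ y < suc M ] f x y

boxSum-cong : ∀ M {f g : ℕ → ℕ → ℤ} → (∀ x y → x ≤ M → y ≤ M → f x y ≡ g x y) →
              boxSum M f ≡ boxSum M g
boxSum-cong M f≗g =
  Σ<-cong (suc M) (λ { x (s≤s x≤M) → Σ<-cong (suc M) (λ { y (s≤s y≤M) → f≗g x y x≤M y≤M }) })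

boxSum-+ : ∀ M (f g : ℕ → ℕ → ℤ) → boxSum M (λ x y → f x y ℤ.+ g x y) ≡ boxSum M f ℤ.+ boxSum M g
boxSum-+ M f g =
  trans (Σ<-cong (suc M) (λ x _ → Σ<-+ (suc M) (f x) (g x)))
        (Σ<-+ (suc M) (λ x → Σ< (suc M) (f x)) (λ x → Σ< (suc M) (g x)))

*-distribˡ-boxSum : ∀ M a (f : ℕ → ℕ → ℤ) → a ℤ.* boxSum M f ≡ boxSum M (λ x y → a ℤ.* f x y)
*-distribˡ-boxSum M a f =
  trans (*-distribˡ-Σ< (suc M) a (λ x → Σ< (suc M) (f x)))
        (Σ<-cong (suc M) (λ x _ → *-distribˡ-Σ< (suc M) a (f x)))

Σ<-boxSum-comm : ∀ n M (f : ℕ → ℕ → ℕ → ℤ) →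
                 Σ[ k < n ] boxSum M (f k) ≡ boxSum M (λ x y → Σ[ k < n ] f k x y)
Σ<-boxSum-comm n M f =
  trans (Σ<-comm n (suc M) (λ k x → Σ< (suc M) (f k x)))
        (Σ<-cong (suc M) (λ x _ → Σ<-comm n (suc M) (λ k → f k x)))

boxSum-extend : ∀ {N M} (f : ℕ → ℕ → ℤ) → N ≤ M → (∀ x y → N < x ⊎ N < y → f x y ≡ + 0) →
                boxSum M f ≡ boxSum N f
boxSum-extend {N} {M} f N≤M f≗0 =
  trans (Σ<-cong (suc M) (λ x _ → Σ<-extend (f x) (s≤s N≤M) (λ y N<y _ → f≗0 x y (inj₂ N<y))))
        (Σ<-extend (λ x → Σ< (suc N) (f x)) (s≤s N≤M)
                   (λ x N<x _ → Σ<-zero (suc N) (λ y _ → f≗0 x y (inj₁ N<x))))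

δ-refl : ∀ a b → δ (a , b) a b ≡ 1
δ-refl a b with a ≟ a | b ≟ b
... | yes _   | yes _   = refl
... | yes _   | no b≢b  = ⊥-elim (b≢b refl)
... | no a≢a  | _       = ⊥-elim (a≢a refl)

δ-≢ : ∀ {a b x y} → (a , b) ≢ (x , y) → δ (a , b) x y ≡ 0
δ-≢ {a} {b} {x} {y} ab≢xy with a ≟ x | b ≟ y
... | yes refl | yes refl = ⊥-elim (ab≢xy refl)
... | yes _    | no _     = refl
... | no _     | _        = refl

δ-outside : ∀ a b x y → a + b < x + y → δ (a , b) x y ≡ 0
δ-outside a b x y a+b<x+y = δ-≢ {a} {b} {x} {y} (λ { refl → <-irrefl refl a+b<x+y })

boxSum-δ : ∀ M (f : ℕ → ℕ → ℤ) {a b} → a ≤ M → b ≤ M →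
           boxSum M (λ x y → f x y ℤ.* + δ (a , b) x y) ≡ f a b
boxSum-δ M f {a} {b} a≤M b≤M = begin
  boxSum M (λ x y → f x y ℤ.* + δ (a , b) x y)
    ≡⟨ Σ<-single (suc M) {λ x → Σ[ y < suc M ] f x y ℤ.* + δ (a , b) x y} a (s≤s a≤M)
         (λ x _ x≢a → Σ<-zero (suc M) (λ y _ → vanish x y (x≢a ∘ sym ∘ cong proj₁))) ⟩
  Σ[ y < suc M ] f a y ℤ.* + δ (a , b) a y
    ≡⟨ Σ<-single (suc M) {λ y → f a y ℤ.* + δ (a , b) a y} b (s≤s b≤M)
         (λ y _ y≢b → vanish a y (y≢b ∘ sym ∘ cong proj₂)) ⟩
  f a b ℤ.* + δ (a , b) a b
    ≡⟨ cong (λ d → f a b ℤ.* + d) (δ-refl a b) ⟩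
  f a b ℤ.* + 1
    ≡⟨ ℤP.*-identityʳ (f a b) ⟩
  f a b ∎
  where
  vanish : ∀ x y → (a , b) ≢ (x , y) → f x y ℤ.* + δ (a , b) x y ≡ + 0
  vanish x y ab≢xy = trans (cong (λ d → f x y ℤ.* + d) (δ-≢ ab≢xy)) (ℤP.*-zeroʳ (f x y))

diagonal : ℕ → ℕ → ℤ
diagonal x y = + y ℤ.- + x

diagonal² : ℕ → ℕ → ℤ
diagonal² x y = diagonal x y ℤ.* diagonal x y

diagonal²-fire : ∀ a b → diagonal² (suc a) b ℤ.+ diagonal² a (suc b) ≡ + 2 ℤ.+ + 2 ℤ.* diagonal² a b
diagonal²-fire a b = spread (+ a) (+ b)
  where
  spread : ∀ i j → (j ℤ.- (+ 1 ℤ.+ i)) ℤ.* (j ℤ.- (+ 1 ℤ.+ i))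
                   ℤ.+ (+ 1 ℤ.+ j ℤ.- i) ℤ.* (+ 1 ℤ.+ j ℤ.- i)
                   ≡ + 2 ℤ.+ + 2 ℤ.* ((j ℤ.- i) ℤ.* (j ℤ.- i))
  spread = solve-∀

moment : Config → ℕ → ℕ → ℤ
moment c x y = diagonal² x y ℤ.* + c x y

boxMoment : ℕ → Config → ℤ
boxMoment M c = boxSum M (moment c)

moment-vanish : ∀ c x y → c x y ≡ 0 → moment c x y ≡ + 0
moment-vanish c x y cxy≡0 = trans (cong (λ m → diagonal² x y ℤ.* + m) cxy≡0) (ℤP.*-zeroʳ (diagonal² x y))

onDiagonal : ℤ → Config → Config
onDiagonal i c x y = if ⌊ diagonal x y ℤ.≟ i ⌋ then c x y else 0

+D≡boxSum : ∀ N c i → + D N c i ≡ boxSum N (λ x y → + onDiagonal i c x y)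
+D≡boxSum N c i = begin
  + sum (concatMap row (upTo (suc N)))     ≡⟨ cong +_ (sum-concatMap row (upTo (suc N))) ⟩
  + sum (map (sum ∘ row) (upTo (suc N)))   ≡⟨ +-sum-map-upTo (suc N) (sum ∘ row) ⟩
  Σ[ x < suc N ] + sum (row x)
    ≡⟨ Σ<-cong (suc N) (λ x _ → +-sum-map-upTo (suc N) (onDiagonal i c x)) ⟩
  boxSum N (λ x y → + onDiagonal i c x y)  ∎
  where
  row : ℕ → List ℕ
  row x = map (onDiagonal i c x) (upTo (suc N))

shift : ℕ → ℕ → ℤ
shift N k = + k ℤ.- + N

shift-injective : ∀ N {k l} → shift N k ≡ shift N l → k ≡ l
shift-injective N eq = ℤP.+-injective (+-cancelʳ (ℤ.- + N) _ _ eq)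

diagonal≡shift : ∀ {N x} y → x ≤ N → diagonal x y ≡ shift N ((N ∸ x) + y)
diagonal≡shift {N} {x} y x≤N = begin
  + y ℤ.- + x                   ≡⟨ ℤP.m-n≡m⊖n y x ⟩
  y ⊖ x                         ≡⟨ ℤP.+-cancelˡ-⊖ (N ∸ x) y x ⟨
  (N ∸ x) + y ⊖ ((N ∸ x) + x)   ≡⟨ cong ((N ∸ x) + y ⊖_) (m∸n+n≡m x≤N) ⟩
  (N ∸ x) + y ⊖ N               ≡⟨ ℤP.m-n≡m⊖n ((N ∸ x) + y) N ⟨
  shift N ((N ∸ x) + y)         ∎

Σ<-onDiagonal : ∀ N c {x y} → x ≤ N → y ≤ N →
                Σ[ k < suc (2 * N) ] shift N k ℤ.* shift N k ℤ.* + onDiagonal (shift N k) c x y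
                  ≡ moment c x y
Σ<-onDiagonal N c {x} {y} x≤N y≤N = trans (Σ<-single (suc (2 * N)) k₀ k₀<1+2N away) at
  where
  k₀ : ℕ
  k₀ = (N ∸ x) + y

  k₀<1+2N : k₀ < suc (2 * N)
  k₀<1+2N = s≤s (+-mono-≤ (m∸n≤m N x) (≤-trans y≤N (m≤m+n N 0)))

  diagonal≡k₀ : diagonal x y ≡ shift N k₀
  diagonal≡k₀ = diagonal≡shift y x≤N

  away : ∀ k → k < suc (2 * N) → k ≢ k₀ →
         shift N k ℤ.* shift N k ℤ.* + onDiagonal (shift N k) c x y ≡ + 0
  away k _ k≢k₀ with diagonal x y ℤ.≟ shift N k
  ... | yes eq = ⊥-elim (k≢k₀ (shift-injective N (trans (sym eq) diagonal≡k₀)))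
  ... | no _   = ℤP.*-zeroʳ (shift N k ℤ.* shift N k)

  at : shift N k₀ ℤ.* shift N k₀ ℤ.* + onDiagonal (shift N k₀) c x y ≡ moment c x y
  at with diagonal x y ℤ.≟ shift N k₀
  ... | yes eq = cong (λ i → i ℤ.* i ℤ.* + c x y) (sym eq)
  ... | no neq = ⊥-elim (neq diagonal≡k₀)

secondMoment≡boxMoment : ∀ N c → secondMoment N c ≡ boxMoment N c
secondMoment≡boxMoment N c = begin
  secondMoment N c
    ≡⟨ foldr-map-upTo (suc (2 * N)) (λ k → shift² k ℤ.* + D N c (shift N k)) ⟩
  Σ[ k < suc (2 * N) ] shift² k ℤ.* + D N c (shift N k)
    ≡⟨ Σ<-cong (suc (2 * N)) (λ k _ → expand k) ⟩
  Σ[ k < suc (2 * N) ] boxSum N (term k)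
    ≡⟨ Σ<-boxSum-comm (suc (2 * N)) N term ⟩
  boxSum N (λ x y → Σ[ k < suc (2 * N) ] term k x y)
    ≡⟨ boxSum-cong N (λ x y x≤N y≤N → Σ<-onDiagonal N c x≤N y≤N) ⟩
  boxMoment N c ∎
  where
  shift² : ℕ → ℤ
  shift² k = shift N k ℤ.* shift N k

  term : ℕ → ℕ → ℕ → ℤ
  term k x y = shift² k ℤ.* + onDiagonal (shift N k) c x y

  expand : ∀ k → shift² k ℤ.* + D N c (shift N k) ≡ boxSum N (term k)
  expand k = trans (cong (ℤ._*_ (shift² k)) (+D≡boxSum N c (shift N k)))
                   (*-distribˡ-boxSum N (shift² k) (λ x y → + onDiagonal (shift N k) c x y))

boxMoment-cong : ∀ M {c d : Config} → (∀ x y → c x y ≡ d x y) → boxMoment M c ≡ boxMoment M d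
boxMoment-cong M c≗d = boxSum-cong M (λ x y _ _ → cong (λ m → diagonal² x y ℤ.* + m) (c≗d x y))

boxMoment-+ : ∀ M (c d : Config) → boxMoment M (λ x y → c x y + d x y) ≡ boxMoment M c ℤ.+ boxMoment M d
boxMoment-+ M c d = trans (boxSum-cong M (λ x y _ _ → distrib x y)) (boxSum-+ M (moment c) (moment d))
  where
  distrib : ∀ x y → diagonal² x y ℤ.* + (c x y + d x y) ≡ moment c x y ℤ.+ moment d x y
  distrib x y = trans (cong (ℤ._*_ (diagonal² x y)) (ℤP.pos-+ (c x y) (d x y)))
                      (ℤP.*-distribˡ-+ (diagonal² x y) (+ c x y) (+ d x y))

boxMoment-* : ∀ M m (c : Config) → boxMoment M (λ x y → m * c x y) ≡ + m ℤ.* boxMoment M c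
boxMoment-* M m c = trans (boxSum-cong M (λ x y _ _ → commute x y)) (sym (*-distribˡ-boxSum M (+ m) (moment c)))
  where
  commute : ∀ x y → diagonal² x y ℤ.* + (m * c x y) ≡ + m ℤ.* moment c x y
  commute x y = trans (cong (ℤ._*_ (diagonal² x y)) (ℤP.pos-* m (c x y)))
                      (*-left-comm (diagonal² x y) (+ m) (+ c x y))

boxMoment-δ : ∀ M {a b} → a ≤ M → b ≤ M → boxMoment M (δ (a , b)) ≡ diagonal² a b
boxMoment-δ M = boxSum-δ M diagonal²

fire-conserves : ∀ c a b → 2 ≤ c a b → ∀ x y →
                 fire c (a , b) x y + 2 * δ (a , b) x y ≡ c x y + δ (suc a , b) x y + δ (a , suc b) x y
fire-conserves c a b 2≤cab x y = m∸n+n≡m lost≤gained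
  where
  lost≤gained : 2 * δ (a , b) x y ≤ c x y + δ (suc a , b) x y + δ (a , suc b) x y
  lost≤gained with a ≟ x | b ≟ y
  ... | yes refl | yes refl = ≤-trans 2≤cab (≤-trans (m≤m+n _ _) (m≤m+n _ _))
  ... | yes _    | no _     = z≤n
  ... | no _     | _        = z≤n

boxMoment-fire : ∀ M c {a b} → 2 ≤ c a b → a < M → b < M →
                 boxMoment M (fire c (a , b)) ≡ boxMoment M c ℤ.+ + 2
boxMoment-fire M c {a} {b} 2≤cab a<M b<M = +-cancelʳ (+ 2 ℤ.* diagonal² a b) _ _ (begin
  boxMoment M (fire c (a , b)) ℤ.+ + 2 ℤ.* diagonal² a b
    ≡⟨ cong (ℤ._+_ (boxMoment M (fire c (a , b)))) lost ⟨
  boxMoment M (fire c (a , b)) ℤ.+ boxMoment M (λ x y → 2 * δ (a , b) x y)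
    ≡⟨ boxMoment-+ M (fire c (a , b)) (λ x y → 2 * δ (a , b) x y) ⟨
  boxMoment M (λ x y → fire c (a , b) x y + 2 * δ (a , b) x y)
    ≡⟨ boxMoment-cong M (fire-conserves c a b 2≤cab) ⟩
  boxMoment M (λ x y → c x y + δ (suc a , b) x y + δ (a , suc b) x y)
    ≡⟨ trans (boxMoment-+ M (λ x y → c x y + δ (suc a , b) x y) (δ (a , suc b)))
             (cong (ℤ._+ boxMoment M (δ (a , suc b))) (boxMoment-+ M c (δ (suc a , b)))) ⟩
  boxMoment M c ℤ.+ boxMoment M (δ (suc a , b)) ℤ.+ boxMoment M (δ (a , suc b))
    ≡⟨ cong₂ (λ p q → boxMoment M c ℤ.+ p ℤ.+ q)
             (boxMoment-δ M a<M (<⇒≤ b<M)) (boxMoment-δ M (<⇒≤ a<M) b<M) ⟩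
  boxMoment M c ℤ.+ diagonal² (suc a) b ℤ.+ diagonal² a (suc b)
    ≡⟨ ℤP.+-assoc (boxMoment M c) _ _ ⟩
  boxMoment M c ℤ.+ (diagonal² (suc a) b ℤ.+ diagonal² a (suc b))
    ≡⟨ cong (ℤ._+_ (boxMoment M c)) (diagonal²-fire a b) ⟩
  boxMoment M c ℤ.+ (+ 2 ℤ.+ + 2 ℤ.* diagonal² a b)
    ≡⟨ ℤP.+-assoc (boxMoment M c) (+ 2) _ ⟨
  boxMoment M c ℤ.+ + 2 ℤ.+ + 2 ℤ.* diagonal² a b ∎)
  where
  lost : boxMoment M (λ x y → 2 * δ (a , b) x y) ≡ + 2 ℤ.* diagonal² a b
  lost = trans (boxMoment-* M 2 (δ (a , b))) (cong (+ 2 ℤ.*_) (boxMoment-δ M (<⇒≤ a<M) (<⇒≤ b<M)))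

SupportedInTriangle : ℕ → Config → Set
SupportedInTriangle k c = ∀ x y → k < x + y → c x y ≡ 0

initial-supportedInTriangle : ∀ n → SupportedInTriangle 0 (initial n)
initial-supportedInTriangle n x y 0<x+y = cong (_* 2 ^ n) (δ-outside 0 0 x y 0<x+y)

firable⇒inTriangle : ∀ {k c a b} → SupportedInTriangle k c → 2 ≤ c a b → a + b ≤ k
firable⇒inTriangle {a = a} {b} supp 2≤cab =
  ≮⇒≥ (λ k<a+b → <⇒≱ (s≤s z≤n) (subst (2 ≤_) (supp a b k<a+b) 2≤cab))

fire-supportedInTriangle : ∀ {k c a b} → SupportedInTriangle k c → a + b ≤ k →
                           SupportedInTriangle (suc k) (fire c (a , b))
fire-supportedInTriangle {k} {c} {a} {b} supp a+b≤k x y 1+k<x+y =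
  trans (cong (_∸ (2 * δ (a , b) x y)) (cong₂ _+_ (cong₂ _+_ no-chip no-right) no-up))
        (0∸n≡0 (2 * δ (a , b) x y))
  where
  no-chip : c x y ≡ 0
  no-chip = supp x y (<⇒≤ 1+k<x+y)

  no-right : δ (suc a , b) x y ≡ 0
  no-right = δ-outside (suc a) b x y (≤-<-trans (s≤s a+b≤k) 1+k<x+y)

  no-up : δ (a , suc b) x y ≡ 0
  no-up = δ-outside a (suc b) x y (≤-<-trans (≤-trans (≤-reflexive (+-suc a b)) (s≤s a+b≤k)) 1+k<x+y)

boxMoment-run : ∀ {M k} c seq → SupportedInTriangle k c → Legal c seq → k + length seq ≤ M →
                boxMoment M (run c seq) ≡ boxMoment M c ℤ.+ + (2 * length seq)
boxMoment-run c [] _ _ _ = sym (ℤP.+-identityʳ _)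
boxMoment-run {M} {k} c ((a , b) ∷ seq) supp (2≤cab , legal) k+len≤M = begin
  boxMoment M (run (fire c (a , b)) seq)
    ≡⟨ boxMoment-run (fire c (a , b)) seq
         (fire-supportedInTriangle {k} {c} {a} {b} supp a+b≤k) legal 1+k+len≤M ⟩
  boxMoment M (fire c (a , b)) ℤ.+ + (2 * length seq)
    ≡⟨ cong (ℤ._+ + (2 * length seq)) (boxMoment-fire M c 2≤cab a<M b<M) ⟩
  boxMoment M c ℤ.+ + 2 ℤ.+ + (2 * length seq)
    ≡⟨ ℤP.+-assoc (boxMoment M c) (+ 2) _ ⟩
  boxMoment M c ℤ.+ + (2 + 2 * length seq)
    ≡⟨ cong (λ m → boxMoment M c ℤ.+ + m) (*-suc 2 (length seq)) ⟨
  boxMoment M c ℤ.+ + (2 * length ((a , b) ∷ seq)) ∎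
  where
  a+b≤k : a + b ≤ k
  a+b≤k = firable⇒inTriangle supp 2≤cab

  1+k+len≤M : suc k + length seq ≤ M
  1+k+len≤M = ≤-trans (≤-reflexive (sym (+-suc k (length seq)))) k+len≤M

  k<M : k < M
  k<M = ≤-trans (m≤m+n (suc k) (length seq)) 1+k+len≤M

  a<M : a < M
  a<M = ≤-<-trans (≤-trans (m≤m+n a b) a+b≤k) k<M

  b<M : b < M
  b<M = ≤-<-trans (≤-trans (m≤n+m b a) a+b≤k) k<M

boxMoment-initial : ∀ M n → boxMoment M (initial n) ≡ + 0
boxMoment-initial M n = Σ<-zero (suc M) (λ x _ → Σ<-zero (suc M) (λ y _ → vanish x y))
  where
  vanish : ∀ x y → moment (initial n) x y ≡ + 0
  vanish zero    zero    = ℤP.*-zeroˡ (+ initial n 0 0)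
  vanish (suc x) y       = moment-vanish (initial n) (suc x) y (initial-supportedInTriangle n (suc x) y z<s)
  vanish zero    (suc y) = moment-vanish (initial n) zero (suc y) (initial-supportedInTriangle n zero (suc y) z<s)

boxMoment-restrict : ∀ {N M c} → SupportedIn N c → N ≤ M → boxMoment M c ≡ boxMoment N c
boxMoment-restrict {c = c} supp N≤M =
  boxSum-extend (moment c) N≤M (λ x y outside → moment-vanish c x y (supp x y outside))

proposition3p2 : (n : ℕ) (seq : List Vertex) → Legal (initial n) seq →
    Stable (run (initial n) seq) →
    (N : ℕ) → SupportedIn N (run (initial n) seq) →
    secondMoment N (run (initial n) seq) ≡ + (2 * length seq)
proposition3p2 n seq legal _ N supp = begin
  secondMoment N final
    ≡⟨ secondMoment≡boxMoment N final ⟩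
  boxMoment N final
    ≡⟨ boxMoment-restrict supp (m≤m+n N (length seq)) ⟨
  boxMoment (N + length seq) final
    ≡⟨ boxMoment-run (initial n) seq (initial-supportedInTriangle n) legal (m≤n+m (length seq) N) ⟩
  boxMoment (N + length seq) (initial n) ℤ.+ + (2 * length seq)
    ≡⟨ cong (ℤ._+ + (2 * length seq)) (boxMoment-initial (N + length seq) n) ⟩
  + (2 * length seq) ∎
  where
  final : Config
  final = run (initial n) seq
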